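{- Let $j,k,n$ be fixed positive integers and $S,T\subseteq[n]$. Let $\mathrm{NCN}^{S,T}_{j,k}(n,r)$ be the number of $r$-colored partitions $\Lambda$ of $[n]$ with $\mathrm{cr}(\Lambda)<j$, $\mathrm{ne}(\Lambda)<k$, $\min(\Lambda)=S$ and $\max(\Lambda)=T$. Then there is a polynomial $p\in\mathbb{Z}[r]$ such that $\mathrm{NCN}^{S,T}_{j,k}(n,r)=p(r)$ for all positive integers $r$.
   Context: For a partition $P$ of $[n]=\{1,\dots,n\}$, $\mathrm{Arc}(P)$ is the set of pairs $(i,j)$ with $i,j$ in the same block and $j$ the least element of that block greater than $i$; $\min(P)$, $\max(P)$ are the sets of minimal and maximal elements of blocks. A $k$-crossing is a sequence of arcs with $i_1<\dots<i_k<j_1<\dots<j_k$, a $k$-nesting one with $i_1<\dots<i_k<j_k<\dots<j_1$. An $r$-colored partition is $\Lambda=(P,\varphi)$ with $\varphi:\mathrm{Arc}(P)\to[r]$; $\mathrm{cr}(\Lambda)$ ($\mathrm{ne}(\Lambda)$) is the largest $k$ such that $P$ has a $k$-crossing ($k$-nesting) whose arcs all have the same color; $\min(\Lambda)=\min(P)$, $\max(\Lambda)=\max(P)$. -}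

module Defs where

open import Data.Bool using (Bool; true; false; _∧_; _∨_; not; if_then_else_)
open import Data.Nat using (ℕ; zero; suc; _<ᵇ_; _≡ᵇ_)
open import Data.Fin using (Fin; toℕ)
open import Data.Fin.Subset using (Subset)
open import Data.List using (List; []; _∷_; map; concatMap; length; allFin; zipWith; reverse)
open import Data.Vec using (Vec; lookup; tabulate; toList)
  renaming ([] to []ᵥ; _∷_ to _∷ᵥ_)
open import Data.Product using (Σ; _×_; _,_; proj₁; proj₂)
open import Data.Integer using (ℤ; _+_; _*_) renaming (0ℤ to zeroℤ)

filterᵇ : {A : Set} → (A → Bool) → List A → List A
filterᵇ p [] = []
filterᵇ p (x ∷ xs) = if p x then x ∷ filterᵇ p xs else filterᵇ p xs

allᵇ : {A : Set} → (A → Bool) → List A → Bool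
allᵇ p [] = true
allᵇ p (x ∷ xs) = p x ∧ allᵇ p xs

anyᵇ : {A : Set} → (A → Bool) → List A → Bool
anyᵇ p [] = false
anyᵇ p (x ∷ xs) = p x ∨ anyᵇ p xs

allVecs : {A : Set} → List A → (k : ℕ) → List (Vec A k)
allVecs xs zero = []ᵥ ∷ []
allVecs xs (suc k) = concatMap (λ x → map (x ∷ᵥ_) (allVecs xs k)) xs

eqVecBool : {m : ℕ} → Vec Bool m → Vec Bool m → Bool
eqVecBool []ᵥ []ᵥ = true
eqVecBool (true ∷ᵥ xs) (true ∷ᵥ ys) = eqVecBool xs ys
eqVecBool (false ∷ᵥ xs) (false ∷ᵥ ys) = eqVecBool xs ys
eqVecBool (_ ∷ᵥ _) (_ ∷ᵥ _) = false

-- Set partitions of [n] = Fin n, as (decidable) equivalence relations,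
-- i.e. "same block" relation, stored as a boolean n×n matrix.

Rel : ℕ → Set
Rel n = Vec (Vec Bool n) n

rel : {n : ℕ} → Rel n → Fin n → Fin n → Bool
rel R a b = lookup (lookup R a) b

_<F_ : {n : ℕ} → Fin n → Fin n → Bool
a <F b = toℕ a <ᵇ toℕ b

isPartition : {n : ℕ} → Rel n → Bool
isPartition {n} R =
  allᵇ (λ a → rel R a a) fs
  ∧ allᵇ (λ a → allᵇ (λ b → not (rel R a b) ∨ rel R b a) fs) fs
  ∧ allᵇ (λ a → allᵇ (λ b → allᵇ (λ c →
        not (rel R a b ∧ rel R b c) ∨ rel R a c) fs) fs) fs
  where fs = allFin n

partitions : (n : ℕ) → List (Rel n)
partitions n = filterᵇ isPartition (allVecs (allVecs (true ∷ false ∷ []) n) n)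

isArc : {n : ℕ} → Rel n → Fin n → Fin n → Bool
isArc {n} R a b =
  rel R a b ∧ (a <F b)
  ∧ not (anyᵇ (λ c → rel R a c ∧ (a <F c) ∧ (c <F b)) (allFin n))

arcs : {n : ℕ} → Rel n → List (Fin n × Fin n)
arcs {n} R = concatMap (λ a → map (a ,_) (filterᵇ (isArc R a) (allFin n))) (allFin n)

isMin : {n : ℕ} → Rel n → Fin n → Bool
isMin {n} R a = not (anyᵇ (λ c → rel R c a ∧ (c <F a)) (allFin n))

isMax : {n : ℕ} → Rel n → Fin n → Bool
isMax {n} R a = not (anyᵇ (λ c → rel R a c ∧ (a <F c)) (allFin n))

minSet : {n : ℕ} → Rel n → Subset n
minSet R = tabulate (isMin R)

maxSet : {n : ℕ} → Rel n → Subset n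
maxSet R = tabulate (isMax R)

-- r-colored partitions: a partition P together with a coloring
-- φ : Arc(P) → [r], stored as a vector of colors indexed by the
-- (canonically ordered) list of arcs of P.

ColoredPartition : ℕ → ℕ → Set
ColoredPartition n r = Σ (Rel n) (λ R → Vec (Fin r) (length (arcs R)))

coloredPartitions : (n r : ℕ) → List (ColoredPartition n r)
coloredPartitions n r =
  concatMap (λ R → map (R ,_) (allVecs (allFin r) (length (arcs R)))) (partitions n)

ColArc : Set
ColArc = ℕ × ℕ × ℕ

colArcs : {n r : ℕ} → ColoredPartition n r → List ColArc
colArcs (R , φ) = zipWith (λ ab c → toℕ (proj₁ ab) , toℕ (proj₂ ab) , toℕ c) (arcs R) (toList φ)

left right color : ColArc → ℕ
left (i , _ , _) = i
right (_ , j , _) = j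
color (_ , _ , c) = c

increasing : (ColArc → ℕ) → List ColArc → Bool
increasing f [] = true
increasing f (x ∷ []) = true
increasing f (x ∷ y ∷ xs) = (f x <ᵇ f y) ∧ increasing f (y ∷ xs)

sameColor : List ColArc → Bool
sameColor [] = true
sameColor (x ∷ xs) = allᵇ (λ y → color y ≡ᵇ color x) xs

lastArc : ColArc → List ColArc → ColArc
lastArc x [] = x
lastArc x (y ∷ ys) = lastArc y ys

isMonoCrossing : List ColArc → Bool
isMonoCrossing [] = true
isMonoCrossing (x ∷ xs) =
  sameColor (x ∷ xs) ∧ increasing left (x ∷ xs) ∧ increasing right (x ∷ xs)
  ∧ (left (lastArc x xs) <ᵇ right x)

isMonoNesting : List ColArc → Bool
isMonoNesting [] = true
isMonoNesting (x ∷ xs) =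
  sameColor (x ∷ xs) ∧ increasing left (x ∷ xs) ∧ increasing right (reverse (x ∷ xs))
  ∧ (left (lastArc x xs) <ᵇ right (lastArc x xs))

hasSeq : (List ColArc → Bool) → List ColArc → ℕ → Bool
hasSeq p as k = anyᵇ (λ v → p (toList v)) (allVecs as k)

largestUpTo : (List ColArc → Bool) → List ColArc → ℕ → ℕ
largestUpTo p as zero = zero
largestUpTo p as (suc m) = if hasSeq p as (suc m) then suc m else largestUpTo p as m

-- cr(Λ), ne(Λ): a k-crossing/nesting consists of k distinct arcs,
-- so k ≤ |Arc(P)| and searching up to the number of arcs suffices.
cr : {n r : ℕ} → ColoredPartition n r → ℕ
cr Λ = largestUpTo isMonoCrossing (colArcs Λ) (length (colArcs Λ))

ne : {n r : ℕ} → ColoredPartition n r → ℕ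
ne Λ = largestUpTo isMonoNesting (colArcs Λ) (length (colArcs Λ))

NCN : (j k n : ℕ) → Subset n → Subset n → (r : ℕ) → ℕ
NCN j k n S T r = length (filterᵇ good (coloredPartitions n r))
  where
  good : ColoredPartition n r → Bool
  good Λ = (cr Λ <ᵇ j) ∧ (ne Λ <ᵇ k)
           ∧ eqVecBool (minSet (proj₁ Λ)) S ∧ eqVecBool (maxSet (proj₁ Λ)) T

-- Polynomials in ℤ[r] as coefficient lists (constant term first)

evalPoly : List ℤ → ℤ → ℤ
evalPoly [] x = zeroℤ
evalPoly (c ∷ cs) x = c + x * evalPoly cs x

-- Whether an r-colouring of the arcs of a fixed partition is counted depends only
-- on which arcs receive equal colours, so the count is unchanged when the colours
-- are renamed injectively. Colour the arcs one at a time and let b bound the colours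
-- used so far: the next arc either reuses one of the b old colours, or receives one
-- of the r − b fresh colours, and all fresh choices are related by a transposition
-- of colours. Hence the number of admissible extensions of a partial colouring is,
-- for r ≥ b, a sum of polynomials plus (r − b) times a polynomial, and by induction
-- on the number of uncoloured arcs the count is a polynomial in r.
module Submission where

open import Data.Bool using (Bool; true; false; if_then_else_; _∧_; _∨_)
open import Data.Empty using (⊥-elim)
open import Data.Fin as Fin using (Fin; toℕ; fromℕ<)
open import Data.Fin.Patterns using (0F)
open import Data.Fin.Permutation using (permutation)
open import Data.Fin.Properties using (toℕ<n; toℕ-fromℕ<; toℕ-injective)
open import Data.Fin.Subset using (Subset)
open import Data.Integer as ℤ using (ℤ; +_; _-_; -_)
import Data.Integer.Properties as ℤ
open import Data.Integer.Solver using (module +-*-Solver)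
open import Data.List
  using (List; []; _∷_; [_]; _++_; map; length; concatMap; zipWith; reverse; allFin; tabulate)
open import Data.List.Properties
  using (map-++; map-id; map-id-local; map-cong; map-∘; map-tabulate; length-map; ++-assoc;
         ++-identityʳ; concatMap-cong; concatMap-map; map-concatMap; zipWith-map; map-zipWith;
         reverse-map)
open import Data.List.Relation.Unary.All as All using (All; []; _∷_)
open import Data.List.Relation.Unary.All.Properties using (++⁺)
open import Data.Nat using (ℕ; zero; suc; _+_; _*_; _∸_; _<_; _≤_; z≤n; _<ᵇ_; _≡ᵇ_)
open import Data.Nat.ListAction using (sum)
import Data.Nat.Properties as ℕ
open import Data.Nat.Properties using (_≟_)
open import Data.Product using (∃-syntax; _,_; proj₁; proj₂; _×_)
open import Data.Vec as Vec using (Vec; toList) renaming (_∷_ to _∷ᵥ_)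
open import Data.Vec.Properties using (toList-map)
open import Function using (_∘_; Injective)
open import Relation.Binary.PropositionalEquality
  using (_≡_; _≢_; refl; sym; trans; cong; cong₂; subst; module ≡-Reasoning)
open import Relation.Nullary using (Dec; yes; no; does)
open import Algebra.Properties.CommutativeMonoid.Sum ℕ.+-0-commutativeMonoid
  using (sum-syntax; sum-cong-≗; sum-permute)

open import Defs

open ≡-Reasoning

infixl 6 _+ₚ_

_+ₚ_ : List ℤ → List ℤ → List ℤ
[]      +ₚ q       = q
(a ∷ p) +ₚ []      = a ∷ p
(a ∷ p) +ₚ (b ∷ q) = a ℤ.+ b ∷ p +ₚ q

mulXMinus : ℤ → List ℤ → List ℤ
mulXMinus b p = (+ 0 ∷ p) +ₚ map ((- b) ℤ.*_) p

open +-*-Solver using (solve; _:+_; _:*_; _:-_; :-_; _:=_; con)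

evalPoly-+ₚ : ∀ p q x → evalPoly (p +ₚ q) x ≡ evalPoly p x ℤ.+ evalPoly q x
evalPoly-+ₚ []      q       x = sym (ℤ.+-identityˡ _)
evalPoly-+ₚ (a ∷ p) []      x = sym (ℤ.+-identityʳ _)
evalPoly-+ₚ (a ∷ p) (b ∷ q) x rewrite evalPoly-+ₚ p q x =
  solve 5 (λ a b x P Q → (a :+ b) :+ x :* (P :+ Q) := (a :+ x :* P) :+ (b :+ x :* Q))
    refl a b x (evalPoly p x) (evalPoly q x)

evalPoly-scale : ∀ c p x → evalPoly (map (c ℤ.*_) p) x ≡ c ℤ.* evalPoly p x
evalPoly-scale c []      x = sym (ℤ.*-zeroʳ c)
evalPoly-scale c (a ∷ p) x rewrite evalPoly-scale c p x =
  solve 4 (λ c a x P → c :* a :+ x :* (c :* P) := c :* (a :+ x :* P))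
    refl c a x (evalPoly p x)

evalPoly-mulXMinus : ∀ b p x → evalPoly (mulXMinus b p) x ≡ (x - b) ℤ.* evalPoly p x
evalPoly-mulXMinus b p x
  rewrite evalPoly-+ₚ (+ 0 ∷ p) (map ((- b) ℤ.*_) p) x | evalPoly-scale (- b) p x =
  solve 3 (λ b x P → (con (+ 0) :+ x :* P) :+ (:- b) :* P := (x :- b) :* P)
    refl b x (evalPoly p x)

PolynomialFrom : ℕ → (ℕ → ℕ) → Set
PolynomialFrom b f = ∃[ p ] ∀ r → b ≤ r → + f r ≡ evalPoly p (+ r)

module _ {b : ℕ} where

  polynomialFrom-cong : ∀ {f g} → (∀ r → b ≤ r → f r ≡ g r) →
                        PolynomialFrom b f → PolynomialFrom b g
  polynomialFrom-cong f≡g (p , agrees) =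
    p , λ r b≤r → trans (cong +_ (sym (f≡g r b≤r))) (agrees r b≤r)

  const-polynomialFrom : ∀ v → PolynomialFrom b (λ _ → v)
  const-polynomialFrom v =
    + v ∷ [] , λ r _ → sym (trans (cong (ℤ._+_ (+ v)) (ℤ.*-zeroʳ (+ r))) (ℤ.+-identityʳ (+ v)))

  +-polynomialFrom : ∀ {f g} → PolynomialFrom b f → PolynomialFrom b g →
                     PolynomialFrom b (λ r → f r + g r)
  +-polynomialFrom {f} {g} (p , p-agrees) (q , q-agrees) = p +ₚ q , λ r b≤r → begin
    + (f r + g r)                         ≡⟨ ℤ.pos-+ (f r) (g r) ⟩
    + f r ℤ.+ + g r                       ≡⟨ cong₂ ℤ._+_ (p-agrees r b≤r) (q-agrees r b≤r) ⟩
    evalPoly p (+ r) ℤ.+ evalPoly q (+ r) ≡⟨ evalPoly-+ₚ p q (+ r) ⟨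
    evalPoly (p +ₚ q) (+ r)               ∎

  ∑-polynomialFrom : ∀ n {F : Fin n → ℕ → ℕ} → (∀ i → PolynomialFrom b (F i)) →
                     PolynomialFrom b (λ r → ∑[ i < n ] F i r)
  ∑-polynomialFrom zero    _            = const-polynomialFrom 0
  ∑-polynomialFrom (suc n) F-polynomial =
    +-polynomialFrom (F-polynomial 0F) (∑-polynomialFrom n (F-polynomial ∘ Fin.suc))

  sum-map-polynomialFrom : ∀ {A : Set} {F : A → ℕ → ℕ} → (∀ a → PolynomialFrom b (F a)) →
                           ∀ xs → PolynomialFrom b (λ r → sum (map (λ a → F a r) xs))
  sum-map-polynomialFrom F-polynomial []       = const-polynomialFrom 0
  sum-map-polynomialFrom F-polynomial (x ∷ xs) =
    +-polynomialFrom (F-polynomial x) (sum-map-polynomialFrom F-polynomial xs)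

  ∸-*-polynomialFrom : ∀ {f} → PolynomialFrom (suc b) f →
                       PolynomialFrom b (λ r → (r ∸ b) * f r)
  ∸-*-polynomialFrom {f} (p , agrees) = mulXMinus (+ b) p , λ r b≤r → begin
    + ((r ∸ b) * f r)                ≡⟨ ℤ.pos-* (r ∸ b) (f r) ⟩
    + (r ∸ b) ℤ.* + f r              ≡⟨ agreesAbove r ⟩
    + (r ∸ b) ℤ.* evalPoly p (+ r)   ≡⟨ cong (ℤ._* _) (trans (ℤ.m-n≡m⊖n r b) (ℤ.⊖-≥ b≤r)) ⟨
    (+ r - + b) ℤ.* evalPoly p (+ r) ≡⟨ evalPoly-mulXMinus (+ b) p (+ r) ⟨
    evalPoly (mulXMinus (+ b) p) (+ r) ∎
    where
    -- at r = b both sides vanish, whatever f b is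
    agreesAbove : ∀ r → + (r ∸ b) ℤ.* + f r ≡ + (r ∸ b) ℤ.* evalPoly p (+ r)
    agreesAbove r with r ∸ b in r∸b≡
    ... | zero  = refl
    ... | suc m = cong (ℤ._*_ (+ suc m)) (agrees r b<r)
      where
      b<r : b < r
      b<r = ℕ.m∸n≢0⇒n<m (λ r∸b≡0 → ℕ.0≢1+n (trans (sym r∸b≡0) r∸b≡))

∑-split : ∀ b c (h : ℕ → ℕ) →
          ∑[ z < b + c ] h (toℕ z) ≡ ∑[ z < b ] h (toℕ z) + ∑[ z < c ] h (b + toℕ z)
∑-split zero    c h = refl
∑-split (suc b) c h = trans (cong (_+_ (h 0)) (∑-split b c (h ∘ suc))) (sym (ℕ.+-assoc (h 0) _ _))

∑-const : ∀ c v → ∑[ z < c ] v ≡ c * v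
∑-const zero    v = refl
∑-const (suc c) v = cong (_+_ v) (∑-const c v)

involutive⇒injective : ∀ {σ : ℕ → ℕ} → (∀ z → σ (σ z) ≡ z) → Injective _≡_ _≡_ σ
involutive⇒injective {σ} invol {x} {y} σx≡σy = begin
  x         ≡⟨ invol x ⟨
  σ (σ x)   ≡⟨ cong σ σx≡σy ⟩
  σ (σ y)   ≡⟨ invol y ⟩
  y         ∎

∑-involution : ∀ r {σ : ℕ → ℕ} → (∀ z → σ (σ z) ≡ z) → (∀ {z} → z < r → σ z < r) →
               ∀ h → ∑[ z < r ] h (σ (toℕ z)) ≡ ∑[ z < r ] h (toℕ z)
∑-involution r {σ} invol σ-< h = begin
  ∑[ z < r ] h (σ (toℕ z))   ≡⟨ sum-cong-≗ (cong h ∘ sym ∘ toℕ-σ′) ⟩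
  ∑[ z < r ] h (toℕ (σ′ z))  ≡⟨ sum-permute (h ∘ toℕ) (permutation σ′ σ′ σ′-involutive σ′-involutive) ⟨
  ∑[ z < r ] h (toℕ z)       ∎
  where
  σ′ : Fin r → Fin r
  σ′ i = fromℕ< (σ-< (toℕ<n i))

  toℕ-σ′ : ∀ i → toℕ (σ′ i) ≡ σ (toℕ i)
  toℕ-σ′ i = toℕ-fromℕ< (σ-< (toℕ<n i))

  σ′-involutive : ∀ i → σ′ (σ′ i) ≡ i
  σ′-involutive i = toℕ-injective (begin
    toℕ (σ′ (σ′ i))  ≡⟨ toℕ-σ′ (σ′ i) ⟩
    σ (toℕ (σ′ i))   ≡⟨ cong σ (toℕ-σ′ i) ⟩
    σ (σ (toℕ i))    ≡⟨ invol (toℕ i) ⟩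
    toℕ i            ∎)

transposeℕ : ℕ → ℕ → ℕ → ℕ
transposeℕ x y z with z ≟ x | z ≟ y
... | yes _ | _     = y
... | no _  | yes _ = x
... | no _  | no _  = z

transposeℕ-x : ∀ x y → transposeℕ x y x ≡ y
transposeℕ-x x y with x ≟ x
... | yes _  = refl
... | no x≢x = ⊥-elim (x≢x refl)

transposeℕ-y : ∀ x y → transposeℕ x y y ≡ x
transposeℕ-y x y with y ≟ x | y ≟ y
... | yes y≡x | _      = y≡x
... | no _    | yes _  = refl
... | no _    | no y≢y = ⊥-elim (y≢y refl)

transposeℕ-fix : ∀ {x y z} → z ≢ x → z ≢ y → transposeℕ x y z ≡ z
transposeℕ-fix {x} {y} {z} z≢x z≢y with z ≟ x | z ≟ y
... | yes z≡x | _       = ⊥-elim (z≢x z≡x)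
... | no _    | yes z≡y = ⊥-elim (z≢y z≡y)
... | no _    | no _    = refl

transposeℕ-involutive : ∀ x y z → transposeℕ x y (transposeℕ x y z) ≡ z
transposeℕ-involutive x y z with z ≟ x | z ≟ y
... | yes refl | _        = transposeℕ-y z y
... | no _     | yes refl = transposeℕ-x x z
... | no z≢x   | no z≢y   = transposeℕ-fix z≢x z≢y

transposeℕ-< : ∀ {x y z r} → x < r → y < r → z < r → transposeℕ x y z < r
transposeℕ-< {x} {y} {z} x<r y<r z<r with z ≟ x | z ≟ y
... | yes _ | _     = y<r
... | no _  | yes _ = x<r
... | no _  | no _  = z<r

filterᵇ-cong : ∀ {A : Set} {p q : A → Bool} → (∀ x → p x ≡ q x) → ∀ xs → filterᵇ p xs ≡ filterᵇ q xs
filterᵇ-cong p≡q []       = refl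
filterᵇ-cong p≡q (x ∷ xs) rewrite p≡q x | filterᵇ-cong p≡q xs = refl

length-filterᵇ-++ : ∀ {A : Set} (p : A → Bool) xs ys →
                    length (filterᵇ p (xs ++ ys)) ≡ length (filterᵇ p xs) + length (filterᵇ p ys)
length-filterᵇ-++ p []       ys = refl
length-filterᵇ-++ p (x ∷ xs) ys with p x
... | true  = cong suc (length-filterᵇ-++ p xs ys)
... | false = length-filterᵇ-++ p xs ys

length-filterᵇ-concatMap : ∀ {A B : Set} (p : B → Bool) (f : A → List B) xs →
                           length (filterᵇ p (concatMap f xs)) ≡ sum (map (λ x → length (filterᵇ p (f x))) xs)
length-filterᵇ-concatMap p f []       = refl
length-filterᵇ-concatMap p f (x ∷ xs) =
  trans (length-filterᵇ-++ p (f x) (concatMap f xs)) (cong (_+_ _) (length-filterᵇ-concatMap p f xs))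

length-filterᵇ-map : ∀ {A B : Set} (p : B → Bool) (g : A → B) xs →
                     length (filterᵇ p (map g xs)) ≡ length (filterᵇ (p ∘ g) xs)
length-filterᵇ-map p g []       = refl
length-filterᵇ-map p g (x ∷ xs) with p (g x)
... | true  = cong suc (length-filterᵇ-map p g xs)
... | false = length-filterᵇ-map p g xs

allᵇ-map : ∀ {A B : Set} (p : B → Bool) (g : A → B) xs → allᵇ p (map g xs) ≡ allᵇ (p ∘ g) xs
allᵇ-map p g []       = refl
allᵇ-map p g (x ∷ xs) = cong (p (g x) ∧_) (allᵇ-map p g xs)

allᵇ-cong : ∀ {A : Set} {p q : A → Bool} → (∀ x → p x ≡ q x) → ∀ xs → allᵇ p xs ≡ allᵇ q xs
allᵇ-cong p≡q []       = refl
allᵇ-cong p≡q (x ∷ xs) = cong₂ _∧_ (p≡q x) (allᵇ-cong p≡q xs)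

anyᵇ-map : ∀ {A B : Set} (p : B → Bool) (g : A → B) xs → anyᵇ p (map g xs) ≡ anyᵇ (p ∘ g) xs
anyᵇ-map p g []       = refl
anyᵇ-map p g (x ∷ xs) = cong (p (g x) ∨_) (anyᵇ-map p g xs)

anyᵇ-cong : ∀ {A : Set} {p q : A → Bool} → (∀ x → p x ≡ q x) → ∀ xs → anyᵇ p xs ≡ anyᵇ q xs
anyᵇ-cong p≡q []       = refl
anyᵇ-cong p≡q (x ∷ xs) = cong₂ _∨_ (p≡q x) (anyᵇ-cong p≡q xs)

allVecs-map : ∀ {A B : Set} (f : A → B) xs k → allVecs (map f xs) k ≡ map (Vec.map f) (allVecs xs k)
allVecs-map f xs zero    = refl
allVecs-map f xs (suc k) = begin
  concatMap (λ y → map (y ∷ᵥ_) (allVecs (map f xs) k)) (map f xs)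
    ≡⟨ concatMap-map _ f xs ⟩
  concatMap (λ x → map (f x ∷ᵥ_) (allVecs (map f xs) k)) xs
    ≡⟨ concatMap-cong extend xs ⟩
  concatMap (λ x → map (Vec.map f) (map (x ∷ᵥ_) (allVecs xs k))) xs
    ≡⟨ map-concatMap (Vec.map f) (λ x → map (x ∷ᵥ_) (allVecs xs k)) xs ⟨
  map (Vec.map f) (concatMap (λ x → map (x ∷ᵥ_) (allVecs xs k)) xs) ∎
  where
  extend : ∀ x → map (f x ∷ᵥ_) (allVecs (map f xs) k) ≡ map (Vec.map f) (map (x ∷ᵥ_) (allVecs xs k))
  extend x = begin
    map (f x ∷ᵥ_) (allVecs (map f xs) k)              ≡⟨ cong (map (f x ∷ᵥ_)) (allVecs-map f xs k) ⟩
    map (f x ∷ᵥ_) (map (Vec.map f) (allVecs xs k))    ≡⟨ map-∘ (allVecs xs k) ⟨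
    map (Vec.map f ∘ (x ∷ᵥ_)) (allVecs xs k)          ≡⟨ map-∘ (allVecs xs k) ⟩
    map (Vec.map f) (map (x ∷ᵥ_) (allVecs xs k))      ∎

sum-tabulate : ∀ n (f : Fin n → ℕ) → sum (tabulate f) ≡ ∑[ i < n ] f i
sum-tabulate zero    f = refl
sum-tabulate (suc n) f = cong (_+_ (f 0F)) (sum-tabulate n (f ∘ Fin.suc))

-- Counting colourings up to renaming of colours

extensions : (List ℕ → Bool) → ℕ → List ℕ → ℕ → ℕ
extensions Q r q zero    = if Q q then 1 else 0
extensions Q r q (suc m) = ∑[ z < r ] extensions Q r (q ++ [ toℕ z ]) m

module _ {Q : List ℕ → Bool}
         (Q-rename : ∀ {g} → Injective _≡_ _≡_ g → ∀ cs → Q (map g cs) ≡ Q cs) where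

  extensions-rename : ∀ {r σ} → (∀ z → σ (σ z) ≡ z) → (∀ {z} → z < r → σ z < r) →
                      ∀ m q → extensions Q r (map σ q) m ≡ extensions Q r q m
  extensions-rename invol σ-< zero    q = cong (if_then 1 else 0) (Q-rename (involutive⇒injective invol) q)
  extensions-rename {r} {σ} invol σ-< (suc m) q = begin
    ∑[ z < r ] extensions Q r (map σ q ++ [ toℕ z ]) m
      ≡⟨ sum-cong-≗ (cong (λ w → extensions Q r w m) ∘ append) ⟩
    ∑[ z < r ] extensions Q r (map σ (q ++ [ σ (toℕ z) ])) m
      ≡⟨ sum-cong-≗ {r} (λ z → extensions-rename invol σ-< m (q ++ [ σ (toℕ z) ])) ⟩
    ∑[ z < r ] extensions Q r (q ++ [ σ (toℕ z) ]) m
      ≡⟨ ∑-involution r invol σ-< (λ z → extensions Q r (q ++ [ z ]) m) ⟩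
    ∑[ z < r ] extensions Q r (q ++ [ toℕ z ]) m
      ∎
    where
    append : ∀ (z : Fin r) → map σ q ++ [ toℕ z ] ≡ map σ (q ++ [ σ (toℕ z) ])
    append z = sym (trans (map-++ σ q _) (cong (λ y → map σ q ++ [ y ]) (invol (toℕ z))))

  -- swap the fresh colours b and z; the colours in q are below b and stay fixed
  extensions-fresh : ∀ {b z r} m {q} → All (_< b) q → b ≤ z → z < r →
                     extensions Q r (q ++ [ z ]) m ≡ extensions Q r (q ++ [ b ]) m
  extensions-fresh {b} {z} {r} m {q} q<b b≤z z<r = begin
    extensions Q r (q ++ [ z ]) m             ≡⟨ cong (λ w → extensions Q r w m) transpose-q++b ⟨
    extensions Q r (map σ (q ++ [ b ])) m     ≡⟨ extensions-rename (transposeℕ-involutive b z) σ-< m (q ++ [ b ]) ⟩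
    extensions Q r (q ++ [ b ]) m             ∎
    where
    σ : ℕ → ℕ
    σ = transposeℕ b z

    σ-< : ∀ {y} → y < r → σ y < r
    σ-< = transposeℕ-< (ℕ.≤-<-trans b≤z z<r) z<r

    transpose-q++b : map σ (q ++ [ b ]) ≡ q ++ [ z ]
    transpose-q++b = begin
      map σ (q ++ [ b ])   ≡⟨ map-++ σ q [ b ] ⟩
      map σ q ++ [ σ b ]   ≡⟨ cong₂ (λ xs y → xs ++ [ y ])
                                     (map-id-local (All.map fixed q<b)) (transposeℕ-x b z) ⟩
      q ++ [ z ]           ∎
      where
      fixed : ∀ {y} → y < b → σ y ≡ y
      fixed y<b = transposeℕ-fix (ℕ.<⇒≢ y<b) (ℕ.<⇒≢ (ℕ.<-≤-trans y<b b≤z))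

  extensions-step : ∀ {b r} m {q} → All (_< b) q → b ≤ r →
                    extensions Q r q (suc m) ≡
                    ∑[ z < b ] extensions Q r (q ++ [ toℕ z ]) m + (r ∸ b) * extensions Q r (q ++ [ b ]) m
  extensions-step {b} {r} m {q} q<b b≤r = begin
    ∑[ z < r ] E (toℕ z)                                ≡⟨ cong (λ n → ∑[ z < n ] E (toℕ z)) b+[r∸b]≡r ⟨
    ∑[ z < b + (r ∸ b) ] E (toℕ z)                      ≡⟨ ∑-split b (r ∸ b) E ⟩
    ∑[ z < b ] E (toℕ z) + ∑[ z < r ∸ b ] E (b + toℕ z) ≡⟨ cong (_+_ _) (sum-cong-≗ fresh) ⟩
    ∑[ z < b ] E (toℕ z) + ∑[ z < r ∸ b ] E b           ≡⟨ cong (_+_ _) (∑-const (r ∸ b) (E b)) ⟩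
    ∑[ z < b ] E (toℕ z) + (r ∸ b) * E b                ∎
    where
    E : ℕ → ℕ
    E z = extensions Q r (q ++ [ z ]) m

    b+[r∸b]≡r : b + (r ∸ b) ≡ r
    b+[r∸b]≡r = ℕ.m+[n∸m]≡n b≤r

    fresh : ∀ (i : Fin (r ∸ b)) → E (b + toℕ i) ≡ E b
    fresh i = extensions-fresh m q<b (ℕ.m≤m+n b (toℕ i))
      (subst (b + toℕ i <_) b+[r∸b]≡r (ℕ.+-monoʳ-< b (toℕ<n i)))

  extensions-polynomialFrom : ∀ m {b q} → All (_< b) q → PolynomialFrom b (λ r → extensions Q r q m)
  extensions-polynomialFrom zero    {q = q} _ = const-polynomialFrom (if Q q then 1 else 0)
  extensions-polynomialFrom (suc m) {b} {q} q<b =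
    polynomialFrom-cong (λ r b≤r → sym (extensions-step m q<b b≤r))
      (+-polynomialFrom
        (∑-polynomialFrom b (λ i → extensions-polynomialFrom m (++⁺ q<b (toℕ<n i ∷ []))))
        (∸-*-polynomialFrom (extensions-polynomialFrom m q++b<1+b)))
    where
    q++b<1+b : All (_< suc b) (q ++ [ b ])
    q++b<1+b = ++⁺ (All.map ℕ.m<n⇒m<1+n q<b) (ℕ.n<1+n b ∷ [])

length-filter-colourings : ∀ Q r m q →
  length (filterᵇ (λ v → Q (q ++ map toℕ (toList v))) (allVecs (allFin r) m)) ≡ extensions Q r q m
length-filter-colourings Q r zero q rewrite ++-identityʳ q with Q q
... | true  = refl
... | false = refl
length-filter-colourings Q r (suc m) q = begin
  length (filterᵇ P (concatMap (λ x → map (x ∷ᵥ_) (allVecs (allFin r) m)) (allFin r)))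
    ≡⟨ length-filterᵇ-concatMap P (λ x → map (x ∷ᵥ_) (allVecs (allFin r) m)) (allFin r) ⟩
  sum (map (λ x → length (filterᵇ P (map (x ∷ᵥ_) (allVecs (allFin r) m)))) (allFin r))
    ≡⟨ cong sum (map-cong extend (allFin r)) ⟩
  sum (map (λ x → extensions Q r (q ++ [ toℕ x ]) m) (allFin r))
    ≡⟨ cong sum (map-tabulate {n = r} (λ i → i) (λ x → extensions Q r (q ++ [ toℕ x ]) m)) ⟩
  sum (tabulate {n = r} (λ x → extensions Q r (q ++ [ toℕ x ]) m))
    ≡⟨ sum-tabulate r _ ⟩
  ∑[ x < r ] extensions Q r (q ++ [ toℕ x ]) m ∎
  where
  P : Vec (Fin r) (suc m) → Bool
  P v = Q (q ++ map toℕ (toList v))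

  extend : ∀ x → length (filterᵇ P (map (x ∷ᵥ_) (allVecs (allFin r) m))) ≡
                 extensions Q r (q ++ [ toℕ x ]) m
  extend x = begin
    length (filterᵇ P (map (x ∷ᵥ_) (allVecs (allFin r) m)))
      ≡⟨ length-filterᵇ-map P (x ∷ᵥ_) (allVecs (allFin r) m) ⟩
    length (filterᵇ (P ∘ (x ∷ᵥ_)) (allVecs (allFin r) m))
      ≡⟨ cong length (filterᵇ-cong reassociate (allVecs (allFin r) m)) ⟩
    length (filterᵇ (λ v → Q ((q ++ [ toℕ x ]) ++ map toℕ (toList v))) (allVecs (allFin r) m))
      ≡⟨ length-filter-colourings Q r m (q ++ [ toℕ x ]) ⟩
    extensions Q r (q ++ [ toℕ x ]) m ∎
    where
    reassociate : ∀ v → P (x ∷ᵥ v) ≡ Q ((q ++ [ toℕ x ]) ++ map toℕ (toList v))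
    reassociate v = cong Q (sym (++-assoc q [ toℕ x ] (map toℕ (toList v))))

-- Crossings and nestings are blind to injective recolourings

recolour : (ℕ → ℕ) → ColArc → ColArc
recolour g (i , j , c) = i , j , g c

increasing-map : ∀ f h → (∀ a → f (h a) ≡ f a) → ∀ as → increasing f (map h as) ≡ increasing f as
increasing-map f h fh≡f []           = refl
increasing-map f h fh≡f (x ∷ [])     = refl
increasing-map f h fh≡f (x ∷ y ∷ as) =
  cong₂ _∧_ (cong₂ _<ᵇ_ (fh≡f x) (fh≡f y)) (increasing-map f h fh≡f (y ∷ as))

lastArc-map : ∀ h x as → lastArc (h x) (map h as) ≡ h (lastArc x as)
lastArc-map h x []       = refl
lastArc-map h x (y ∷ as) = lastArc-map h y as

module _ {g : ℕ → ℕ} (g-injective : Injective _≡_ _≡_ g) where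

  -- m ≡ᵇ n is does (m ≟ n) by the definition of _≟_
  ≡ᵇ-injective : ∀ a b → (g a ≡ᵇ g b) ≡ (a ≡ᵇ b)
  ≡ᵇ-injective a b = does-injective (a ≟ b) (g a ≟ g b)
    where
    does-injective : (a≟b : Dec (a ≡ b)) (ga≟gb : Dec (g a ≡ g b)) → does ga≟gb ≡ does a≟b
    does-injective (yes _)   (yes _)     = refl
    does-injective (no _)    (no _)      = refl
    does-injective (yes a≡b) (no ga≢gb)  = ⊥-elim (ga≢gb (cong g a≡b))
    does-injective (no a≢b)  (yes ga≡gb) = ⊥-elim (a≢b (g-injective ga≡gb))

  sameColor-recolour : ∀ as → sameColor (map (recolour g) as) ≡ sameColor as
  sameColor-recolour []       = refl
  sameColor-recolour (x ∷ as) =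
    trans (allᵇ-map _ (recolour g) as) (allᵇ-cong (λ y → ≡ᵇ-injective (color y) (color x)) as)

  isMonoCrossing-recolour : ∀ as → isMonoCrossing (map (recolour g) as) ≡ isMonoCrossing as
  isMonoCrossing-recolour []       = refl
  isMonoCrossing-recolour (x ∷ as) =
    cong₂ _∧_ (sameColor-recolour (x ∷ as))
    (cong₂ _∧_ (increasing-map left (recolour g) (λ _ → refl) (x ∷ as))
    (cong₂ _∧_ (increasing-map right (recolour g) (λ _ → refl) (x ∷ as))
               (cong (λ a → left a <ᵇ right x) (lastArc-map (recolour g) x as))))

  isMonoNesting-recolour : ∀ as → isMonoNesting (map (recolour g) as) ≡ isMonoNesting as
  isMonoNesting-recolour []       = refl
  isMonoNesting-recolour (x ∷ as) =
    cong₂ _∧_ (sameColor-recolour (x ∷ as))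
    (cong₂ _∧_ (increasing-map left (recolour g) (λ _ → refl) (x ∷ as))
    (cong₂ _∧_ (trans (cong (increasing right) (sym (reverse-map (recolour g) (x ∷ as))))
                      (increasing-map right (recolour g) (λ _ → refl) (reverse (x ∷ as))))
               (cong (λ a → left a <ᵇ right a) (lastArc-map (recolour g) x as))))

module _ {p : List ColArc → Bool} {h : ColArc → ColArc} (p-map : ∀ as → p (map h as) ≡ p as) where

  hasSeq-map : ∀ as k → hasSeq p (map h as) k ≡ hasSeq p as k
  hasSeq-map as k = begin
    anyᵇ (p ∘ toList) (allVecs (map h as) k)            ≡⟨ cong (anyᵇ (p ∘ toList)) (allVecs-map h as k) ⟩
    anyᵇ (p ∘ toList) (map (Vec.map h) (allVecs as k))  ≡⟨ anyᵇ-map (p ∘ toList) (Vec.map h) (allVecs as k) ⟩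
    anyᵇ (p ∘ toList ∘ Vec.map h) (allVecs as k)        ≡⟨ anyᵇ-cong p-toList-map (allVecs as k) ⟩
    anyᵇ (p ∘ toList) (allVecs as k)                    ∎
    where
    p-toList-map : ∀ {k} (v : Vec ColArc k) → p (toList (Vec.map h v)) ≡ p (toList v)
    p-toList-map v = trans (cong p (toList-map h v)) (p-map (toList v))

  largestUpTo-map : ∀ as m → largestUpTo p (map h as) m ≡ largestUpTo p as m
  largestUpTo-map as zero = refl
  largestUpTo-map as (suc m) rewrite hasSeq-map as (suc m) | largestUpTo-map as m = refl

  largestUpTo-length-map : ∀ as → largestUpTo p (map h as) (length (map h as)) ≡ largestUpTo p as (length as)
  largestUpTo-length-map as =
    trans (cong (largestUpTo p (map h as)) (length-map h as)) (largestUpTo-map as (length as))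

crossingNumber nestingNumber : List ColArc → ℕ
crossingNumber as = largestUpTo isMonoCrossing as (length as)
nestingNumber  as = largestUpTo isMonoNesting as (length as)

zipWith-mapʳ : ∀ {A B C D : Set} (f : A → B → C) (g : D → B) xs ys →
               zipWith f xs (map g ys) ≡ zipWith (λ x y → f x (g y)) xs ys
zipWith-mapʳ f g xs ys =
  trans (cong (λ zs → zipWith f zs (map g ys)) (sym (map-id xs))) (zipWith-map f (λ x → x) g xs ys)

module _ (j k : ℕ) {n : ℕ} (S T : Subset n) where

  labelArc : Fin n × Fin n → ℕ → ColArc
  labelArc ab c = toℕ (proj₁ ab) , toℕ (proj₂ ab) , c

  labelArcs : Rel n → List ℕ → List ColArc
  labelArcs R = zipWith labelArc (arcs R)

  labelArcs-rename : ∀ R g cs → labelArcs R (map g cs) ≡ map (recolour g) (labelArcs R cs)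
  labelArcs-rename R g cs =
    trans (zipWith-mapʳ labelArc g (arcs R) cs) (sym (map-zipWith labelArc (recolour g) (arcs R) cs))

  admissibleArcs : Rel n → List ColArc → Bool
  admissibleArcs R as = (crossingNumber as <ᵇ j) ∧ (nestingNumber as <ᵇ k)
                        ∧ eqVecBool (minSet R) S ∧ eqVecBool (maxSet R) T

  admissible : Rel n → List ℕ → Bool
  admissible R cs = admissibleArcs R (labelArcs R cs)

  admissible-rename : ∀ R {g} → Injective _≡_ _≡_ g → ∀ cs → admissible R (map g cs) ≡ admissible R cs
  admissible-rename R {g} g-injective cs = begin
    admissibleArcs R (labelArcs R (map g cs))
      ≡⟨ cong (admissibleArcs R) (labelArcs-rename R g cs) ⟩
    admissibleArcs R (map (recolour g) (labelArcs R cs))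
      ≡⟨ cong₂ (λ c ν → (c <ᵇ j) ∧ (ν <ᵇ k) ∧ eqVecBool (minSet R) S ∧ eqVecBool (maxSet R) T)
               (largestUpTo-length-map (isMonoCrossing-recolour g-injective) (labelArcs R cs))
               (largestUpTo-length-map (isMonoNesting-recolour g-injective) (labelArcs R cs)) ⟩
    admissibleArcs R (labelArcs R cs)
      ∎

  NCN≡∑extensions : ∀ r → NCN j k n S T r ≡
                    sum (map (λ R → extensions (admissible R) r [] (length (arcs R))) (partitions n))
  NCN≡∑extensions r = begin
    NCN j k n S T r
      ≡⟨ cong length (filterᵇ-cong colArcs-labelArcs (coloredPartitions n r)) ⟩
    length (filterᵇ counted (concatMap (λ R → map (R ,_) (colourings R)) (partitions n)))
      ≡⟨ length-filterᵇ-concatMap counted (λ R → map (R ,_) (colourings R)) (partitions n) ⟩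
    sum (map (λ R → length (filterᵇ counted (map (R ,_) (colourings R)))) (partitions n))
      ≡⟨ cong sum (map-cong counted-colourings (partitions n)) ⟩
    sum (map (λ R → extensions (admissible R) r [] (length (arcs R))) (partitions n)) ∎
    where
    colourings : ∀ R → List (Vec (Fin r) (length (arcs R)))
    colourings R = allVecs (allFin r) (length (arcs R))

    counted : ColoredPartition n r → Bool
    counted (R , φ) = admissible R (map toℕ (toList φ))

    -- the left-hand side is, unfolded, the predicate by which NCN filters
    colArcs-labelArcs : ∀ Λ → admissibleArcs (proj₁ Λ) (colArcs Λ) ≡ counted Λ
    colArcs-labelArcs (R , φ) = cong (admissibleArcs R) (sym (zipWith-mapʳ labelArc toℕ (arcs R) (toList φ)))

    counted-colourings : ∀ R → length (filterᵇ counted (map (R ,_) (colourings R))) ≡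
                      extensions (admissible R) r [] (length (arcs R))
    counted-colourings R = trans (length-filterᵇ-map counted (R ,_) (colourings R))
                        (length-filter-colourings (admissible R) r (length (arcs R)) [])

proposition4p3 : (j k n : ℕ) → 0 < j → 0 < k → 0 < n → (S T : Subset n) →
    ∃[ p ] ((r : ℕ) → 0 < r → + (NCN j k n S T r) ≡ evalPoly p (+ r))
proposition4p3 j k n _ _ _ S T =
  let p , agrees = sum-map-polynomialFrom
                     (λ R → extensions-polynomialFrom (admissible-rename j k S T R) (length (arcs R)) [])
                     (partitions n)
  in p , λ r _ → trans (cong +_ (NCN≡∑extensions j k S T r)) (agrees r z≤n)
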